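{- For every $n\ge1$, $\displaystyle\sum_{w\in S_n}(-1)^{\ell(w)}G_w=\prod_{i\le 0}(1-x_i)^{n-1}$.
   Context: $S_n$ is the group of permutations of $\{1,\dots,n\}$, generated by $s_i$ ($1\le i<n$) exchanging $i,i+1$; $\ell$ length; the Hecke product $*$ is associative with identity and $s_i*w=s_iw$ if $\ell(s_iw)>\ell(w)$, $s_i*w=w$ otherwise. For $w\in S_n$, the $K$-Stanley function is the symmetric power series in $x_i$ ($i\le0$) $G_w=\sum(-1)^{p-\ell(w)}x_{i_1}\cdots x_{i_p}$, summed over $p\ge0$, integer sequences $(a_1,\dots,a_p)$ with $s_{a_1}*\cdots*s_{a_p}=w$, and integers $i_1\le\cdots\le i_p\le0$ such that $a_k\le a_{k+1}$ implies $i_k<i_{k+1}$. -}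

module Defs where

open import Data.Bool using (Bool; true; false; if_then_else_; not; _∧_; _∨_)
open import Data.Nat as ℕ using (ℕ; zero; suc; _∸_)
open import Data.Integer as ℤ using (ℤ; +_; -_; -1ℤ; 0ℤ; 1ℤ)
open import Data.List using (List; []; _∷_; _++_; map; replicate; concatMap; upTo; filterᵇ; foldr; length)
open import Data.List.Properties using (≡-dec)
open import Data.Product using (_×_; _,_)
open import Relation.Nullary.Decidable using (⌊_⌋)

-- Permutations of {1..n} in one-line notation: w = [w(1), ..., w(n)].

range : ℕ → List ℕ
range n = map suc (upTo n)

seqs : ℕ → List ℕ → List (List ℕ)
seqs zero    xs = [] ∷ []
seqs (suc p) xs = concatMap (λ x → map (x ∷_) (seqs p xs)) xs

_==_ : ℕ → ℕ → Bool
m == n = ⌊ m ℕ.≟ n ⌋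

_==L_ : List ℕ → List ℕ → Bool
u ==L v = ⌊ ≡-dec ℕ._≟_ u v ⌋

notIn : ℕ → List ℕ → Bool
notIn x []       = true
notIn x (y ∷ ys) = not (x == y) ∧ notIn x ys

noDup : List ℕ → Bool
noDup []       = true
noDup (x ∷ xs) = notIn x xs ∧ noDup xs

Sn : ℕ → List (List ℕ)
Sn n = filterᵇ noDup (seqs n (range n))

idPerm : ℕ → List ℕ
idPerm n = range n

-- Coxeter length = number of inversions
countGreater : ℕ → List ℕ → ℕ
countGreater x []       = 0
countGreater x (y ∷ ys) = (if y ℕ.<ᵇ x then 1 else 0) ℕ.+ countGreater x ys

len : List ℕ → ℕ
len []       = 0
len (x ∷ xs) = countGreater x xs ℕ.+ len xs

-- s_i w (composition s_i ∘ w): exchange the values i and i+1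
sw : ℕ → ℕ → ℕ
sw i v = if v == i then suc i else (if v == suc i then i else v)

leftMul : ℕ → List ℕ → List ℕ
leftMul i w = map (sw i) w

hstep : ℕ → List ℕ → List ℕ
hstep i w = if len w ℕ.<ᵇ len (leftMul i w) then leftMul i w else w

-- s_{a1} * ... * s_{ap} in S_n
hecke : ℕ → List ℕ → List ℕ
hecke n as = foldr hstep (idPerm n) as

-- Monomials in the variables x_i (i ≤ 0): an exponent list α where α[k] is the
-- exponent of x_{-k} (finitely supported; positions beyond the list are 0).

sumℕ : List ℕ → ℕ
sumℕ = foldr ℕ._+_ 0

sumℤ : List ℤ → ℤ
sumℤ = foldr ℤ._+_ 0ℤ

prodℤ : List ℤ → ℤ
prodℤ = foldr ℤ._*_ 1ℤ

-- the unique weakly increasing sequence i_1 ≤ ... ≤ i_p ≤ 0 with x_{i_1}⋯x_{i_p} = x^α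
iSeqAux : ℕ → List ℕ → List ℤ
iSeqAux k []       = []
iSeqAux k (a ∷ as) = iSeqAux (suc k) as ++ replicate a (- (+ k))

iSeq : List ℕ → List ℤ
iSeq α = iSeqAux 0 α

_<ℤᵇ_ : ℤ → ℤ → Bool
i <ℤᵇ j = not (j ℤ.≤ᵇ i)

compat : List (ℕ × ℤ) → Bool
compat []                               = true
compat (_ ∷ [])                         = true
compat ((a , i) ∷ (a' , i') ∷ rest) =
  (not (a ℕ.≤ᵇ a') ∨ (i <ℤᵇ i')) ∧ compat ((a' , i') ∷ rest)

zipL : List ℕ → List ℤ → List (ℕ × ℤ)
zipL []       _        = []
zipL _        []       = []
zipL (a ∷ as) (i ∷ is) = (a , i) ∷ zipL as is

sgn : ℕ → ℤ
sgn zero    = 1ℤ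
sgn (suc k) = - sgn k

-- coefficient of x^α in G_w (w ∈ S_n); the sum runs over all words a in
-- {1..n-1}^p, p = |α| (the s_a are only defined for 1 ≤ a < n).
-- (-1)^{p - ℓ(w)} is written (-1)^{p + ℓ(w)} (same parity).
coeffG : ℕ → List ℕ → List ℕ → ℤ
coeffG n w α =
  sumℤ (map (λ as → if compat (zipL as (iSeq α)) ∧ (hecke n as ==L w)
                    then sgn (sumℕ α ℕ.+ len w) else 0ℤ)
            (seqs (sumℕ α) (range (n ∸ 1))))

-- coefficient of x^α in Σ_{w ∈ S_n} (-1)^{ℓ(w)} G_w
lhsCoeff : ℕ → List ℕ → ℤ
lhsCoeff n α = sumℤ (map (λ w → sgn (len w) ℤ.* coeffG n w α) (Sn n))

-- one-variable polynomials as coefficient lists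
polyAdd : List ℤ → List ℤ → List ℤ
polyAdd []       q        = q
polyAdd p        []       = p
polyAdd (a ∷ p) (b ∷ q)   = (a ℤ.+ b) ∷ polyAdd p q

mulOneMinusX : List ℤ → List ℤ
mulOneMinusX p = polyAdd p (0ℤ ∷ map -_ p)

powOneMinusX : ℕ → List ℤ
powOneMinusX zero    = 1ℤ ∷ []
powOneMinusX (suc m) = mulOneMinusX (powOneMinusX m)

coeffAt : List ℤ → ℕ → ℤ
coeffAt []      _       = 0ℤ
coeffAt (c ∷ p) zero    = c
coeffAt (c ∷ p) (suc k) = coeffAt p k

-- coefficient of x^α in ∏_{i ≤ 0} (1 - x_i)^{n-1}
rhsCoeff : ℕ → List ℕ → ℤ
rhsCoeff n α = prodℤ (map (coeffAt (powOneMinusX (n ∸ 1))) α)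

-- Summing (-1)^ℓ(w) G_w over all w ∈ S_n forgets the Hecke product of a word:
-- every word in the letters 1, …, n-1 has exactly one Hecke product in S_n,
-- and (-1)^ℓ(w) (-1)^(|α| - ℓ(w)) = (-1)^|α|.  So the coefficient of x^α is
-- (-1)^|α| times the number of words compatible with the weakly increasing
-- index sequence of x^α.  That sequence is a concatenation of blocks of equal
-- indices, one block of length α_k for each variable; compatibility forces the
-- letters inside a block to decrease strictly and imposes nothing across
-- blocks, where the index increases.  Strictly decreasing words of length a in
-- 1, …, n-1 are counted by C(n-1, a), so the coefficient is
-- ∏_k (-1)^α_k C(n-1, α_k), which is also the coefficient of x^α in
-- ∏_i (1 - x_i)^(n-1).

{-# OPTIONS --safe #-}
module Submission where

open import Defs
open import Data.Bool using (Bool; true; false; if_then_else_; not; _∧_; _∨_; T)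
import Data.Bool.Properties as BoolP
open import Data.Nat as ℕ using (ℕ; zero; suc; _≤_; _<_; z≤n; s≤s; _≡ᵇ_; _<ᵇ_; _≤ᵇ_)
import Data.Nat.Properties as ℕP
open import Data.Nat.Combinatorics using (_C_; nCk+nC[k+1]≡[n+1]C[k+1])
open import Data.Integer as ℤ using (ℤ; +_; -_; 0ℤ; 1ℤ; _+_; _*_)
import Data.Integer.Properties as ℤP
open import Data.Integer.Tactic.RingSolver using (solve-∀)
open import Data.List using (List; []; _∷_; _++_; map; replicate; concatMap; upTo; filterᵇ; length)
import Data.List.Properties as ListP
open import Data.List.Membership.Propositional.Properties using (∈-upTo⁻)
open import Data.List.Relation.Unary.All as All using (All; []; _∷_)
import Data.List.Relation.Unary.All.Properties as AllP
open import Data.Product using (_×_; _,_; proj₁; proj₂)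
open import Data.Sum using (inj₁; inj₂)
open import Data.Unit using (tt)
open import Function using (_∘_; Equivalence; Injective)
open import Relation.Binary.PropositionalEquality
open import Relation.Nullary.Decidable using (isYes≗does; dec-true; dec-false)
open import Relation.Nullary using (Dec; yes; no; contradiction)

T⇒≡true : ∀ {b} → T b → b ≡ true
T⇒≡true = Equivalence.to BoolP.T-≡

<ᵇ≡false : ∀ {m n} → n ≤ m → (m <ᵇ n) ≡ false
<ᵇ≡false {m} {n} n≤m with m <ᵇ n in eq
... | true  = contradiction (ℕP.<ᵇ⇒< m n (subst T (sym eq) tt)) (ℕP.≤⇒≯ n≤m)
... | false = refl

not-≤ᵇ : ∀ m n → not (m ≤ᵇ n) ≡ (n <ᵇ m)
not-≤ᵇ zero          n       = refl
not-≤ᵇ (suc m)       zero    = refl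
not-≤ᵇ (suc zero)    (suc n) = refl
not-≤ᵇ (suc (suc m)) (suc n) = not-≤ᵇ (suc m) n

<⇒<ℤᵇ : ∀ {i j} → i ℤ.< j → (i <ℤᵇ j) ≡ true
<⇒<ℤᵇ {i} {j} i<j with j ℤ.≤ᵇ i in eq
... | true  = contradiction (ℤP.≤ᵇ⇒≤ (subst T (sym eq) tt)) (ℤP.<⇒≱ i<j)
... | false = refl

<ℤᵇ-irrefl : ∀ c → (c <ℤᵇ c) ≡ false
<ℤᵇ-irrefl c = cong not (T⇒≡true (ℤP.≤⇒≤ᵇ (ℤP.≤-refl {c})))

-- Finite sums

private
  variable
    A B : Set

∑ : List A → (A → ℤ) → ℤ
∑ xs f = sumℤ (map f xs)

infix 5 ∑
syntax ∑ xs (λ x → e) = ∑[ x ∈ xs ] e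

infixr 8 ⟦_⟧·_
⟦_⟧·_ : Bool → ℤ → ℤ
⟦ b ⟧· s = if b then s else 0ℤ

⟦_⟧ : Bool → ℤ
⟦ b ⟧ = ⟦ b ⟧· 1ℤ

∑-++ : ∀ xs ys (f : A → ℤ) → ∑ (xs ++ ys) f ≡ ∑ xs f + ∑ ys f
∑-++ []       ys f = sym (ℤP.+-identityˡ _)
∑-++ (x ∷ xs) ys f = trans (cong (_+_ (f x)) (∑-++ xs ys f)) (sym (ℤP.+-assoc (f x) _ _))

∑-map : ∀ (g : B → A) xs (f : A → ℤ) → ∑ (map g xs) f ≡ ∑ xs (f ∘ g)
∑-map g []       f = refl
∑-map g (x ∷ xs) f = cong (_+_ (f (g x))) (∑-map g xs f)

∑-congᴬ : ∀ {P : A → Set} {f g : A → ℤ} xs → All P xs → (∀ {x} → P x → f x ≡ g x) → ∑ xs f ≡ ∑ xs g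
∑-congᴬ []       []         f≗g = refl
∑-congᴬ (x ∷ xs) (px ∷ pxs) f≗g = cong₂ _+_ (f≗g px) (∑-congᴬ xs pxs f≗g)

∑-cong : ∀ {f g : A → ℤ} xs → (∀ x → f x ≡ g x) → ∑ xs f ≡ ∑ xs g
∑-cong xs f≗g = ∑-congᴬ xs (All.universal (λ _ → tt) xs) λ {x} _ → f≗g x

∑-zero : ∀ (xs : List A) → ∑[ x ∈ xs ] 0ℤ ≡ 0ℤ
∑-zero []       = refl
∑-zero (x ∷ xs) = trans (ℤP.+-identityˡ _) (∑-zero xs)

∑-+ : ∀ xs (f g : A → ℤ) → ∑[ x ∈ xs ] (f x + g x) ≡ ∑ xs f + ∑ xs g
∑-+ []       f g = refl
∑-+ (x ∷ xs) f g = trans (cong (_+_ (f x + g x)) (∑-+ xs f g)) (interchange (f x) (g x) _ _)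
  where
  interchange : ∀ a b c d → a + b + (c + d) ≡ a + c + (b + d)
  interchange = solve-∀

∑-*ˡ : ∀ c xs (f : A → ℤ) → c * ∑ xs f ≡ ∑[ x ∈ xs ] (c * f x)
∑-*ˡ c []       f = ℤP.*-zeroʳ c
∑-*ˡ c (x ∷ xs) f = trans (ℤP.*-distribˡ-+ c (f x) _) (cong (_+_ (c * f x)) (∑-*ˡ c xs f))

∑-comm : ∀ xs (ys : List B) (F : A → B → ℤ) →
         ∑[ x ∈ xs ] ∑[ y ∈ ys ] F x y ≡ ∑[ y ∈ ys ] ∑[ x ∈ xs ] F x y
∑-comm []       ys F = sym (∑-zero ys)
∑-comm (x ∷ xs) ys F = trans (cong (_+_ (∑ ys (F x))) (∑-comm xs ys F)) (sym (∑-+ ys (F x) _))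

∑-*-∑ : ∀ xs (ys : List B) (f : A → ℤ) (g : B → ℤ) →
        ∑[ x ∈ xs ] ∑[ y ∈ ys ] (f x * g y) ≡ ∑ xs f * ∑ ys g
∑-*-∑ []       ys f g = refl
∑-*-∑ (x ∷ xs) ys f g =
  trans (cong₂ _+_ (sym (∑-*ˡ (f x) ys g)) (∑-*-∑ xs ys f g)) (sym (ℤP.*-distribʳ-+ (∑ ys g) (f x) _))

∑-concatMap : ∀ (g : A → List B) xs (f : B → ℤ) → ∑ (concatMap g xs) f ≡ ∑[ x ∈ xs ] ∑ (g x) f
∑-concatMap g []       f = refl
∑-concatMap g (x ∷ xs) f = trans (∑-++ (g x) _ f) (cong (_+_ (∑ (g x) f)) (∑-concatMap g xs f))

∑-filterᵇ : ∀ (p : A → Bool) xs (f : A → ℤ) → ∑ (filterᵇ p xs) f ≡ ∑[ x ∈ xs ] ⟦ p x ⟧· f x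
∑-filterᵇ p []       f = refl
∑-filterᵇ p (x ∷ xs) f with p x
... | true  = cong (_+_ (f x)) (∑-filterᵇ p xs f)
... | false = trans (∑-filterᵇ p xs f) (sym (ℤP.+-identityˡ _))

∑-⟦⟧ : ∀ b xs (f : A → ℤ) → ∑[ x ∈ xs ] ⟦ b ⟧· f x ≡ ⟦ b ⟧· ∑ xs f
∑-⟦⟧ true  xs f = refl
∑-⟦⟧ false xs f = ∑-zero xs

⟦∧⟧ : ∀ a b s → ⟦ a ∧ b ⟧· s ≡ ⟦ a ⟧· ⟦ b ⟧· s
⟦∧⟧ true  b s = refl
⟦∧⟧ false b s = refl

∑-⟦∧⟧ : ∀ a (p : A → Bool) xs (f : A → ℤ) → ∑[ x ∈ xs ] ⟦ a ∧ p x ⟧· f x ≡ ⟦ a ⟧· (∑[ x ∈ xs ] ⟦ p x ⟧· f x)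
∑-⟦∧⟧ a p xs f = trans (∑-cong xs λ x → ⟦∧⟧ a (p x) (f x)) (∑-⟦⟧ a xs _)

⟦⟧-*ʳ : ∀ b s → ⟦ b ⟧· s ≡ s * ⟦ b ⟧
⟦⟧-*ʳ true  s = sym (ℤP.*-identityʳ s)
⟦⟧-*ʳ false s = sym (ℤP.*-zeroʳ s)

*-⟦⟧ : ∀ c b s → c * ⟦ b ⟧· s ≡ ⟦ b ⟧· (c * s)
*-⟦⟧ c true  s = refl
*-⟦⟧ c false s = ℤP.*-zeroʳ c

⟦∧⟧-* : ∀ a b → ⟦ a ∧ b ⟧ ≡ ⟦ a ⟧ * ⟦ b ⟧
⟦∧⟧-* true  b = sym (ℤP.*-identityˡ _)
⟦∧⟧-* false b = refl

∑-seqs-suc : ∀ p (X : List ℕ) (f : List ℕ → ℤ) → ∑ (seqs (suc p) X) f ≡ ∑[ x ∈ X ] ∑[ as ∈ seqs p X ] f (x ∷ as)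
∑-seqs-suc p X f = trans (∑-concatMap _ X f) (∑-cong X λ x → ∑-map (x ∷_) (seqs p X) f)

∑-seqs-+ : ∀ p q (X : List ℕ) (f : List ℕ → ℤ) →
           ∑ (seqs (p ℕ.+ q) X) f ≡ ∑[ bs ∈ seqs p X ] ∑[ cs ∈ seqs q X ] f (bs ++ cs)
∑-seqs-+ zero    q X f = sym (ℤP.+-identityʳ _)
∑-seqs-+ (suc p) q X f = begin
  ∑ (seqs (suc p ℕ.+ q) X) f                                      ≡⟨ ∑-seqs-suc (p ℕ.+ q) X f ⟩
  ∑[ x ∈ X ] ∑[ as ∈ seqs (p ℕ.+ q) X ] f (x ∷ as)               ≡⟨ ∑-cong X (λ x → ∑-seqs-+ p q X (f ∘ (x ∷_))) ⟩
  ∑[ x ∈ X ] ∑[ bs ∈ seqs p X ] ∑[ cs ∈ seqs q X ] f (x ∷ bs ++ cs) ≡⟨ ∑-seqs-suc p X _ ⟨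
  ∑[ bs ∈ seqs (suc p) X ] ∑[ cs ∈ seqs q X ] f (bs ++ cs)          ∎
  where open ≡-Reasoning

∑-seqs-congᴬ : ∀ {P : ℕ → Set} {X : List ℕ} → All P X → ∀ p {f g : List ℕ → ℤ} →
               (∀ as → length as ≡ p → All P as → f as ≡ g as) → ∑ (seqs p X) f ≡ ∑ (seqs p X) g
∑-seqs-congᴬ PX zero    f≗g = cong (_+ 0ℤ) (f≗g [] refl [])
∑-seqs-congᴬ {X = X} PX (suc p) {f} {g} f≗g = begin
  ∑ (seqs (suc p) X) f                    ≡⟨ ∑-seqs-suc p X f ⟩
  ∑[ x ∈ X ] ∑[ as ∈ seqs p X ] f (x ∷ as) ≡⟨ ∑-congᴬ X PX (λ px → ∑-seqs-congᴬ PX p (λ as l pas → f≗g (_ ∷ as) (cong suc l) (px ∷ pas))) ⟩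
  ∑[ x ∈ X ] ∑[ as ∈ seqs p X ] g (x ∷ as) ≡⟨ ∑-seqs-suc p X g ⟨
  ∑ (seqs (suc p) X) g                    ∎
  where open ≡-Reasoning

∑-seqs-cong : ∀ {X : List ℕ} p {f g : List ℕ → ℤ} →
              (∀ as → length as ≡ p → f as ≡ g as) → ∑ (seqs p X) f ≡ ∑ (seqs p X) g
∑-seqs-cong {X} p f≗g = ∑-seqs-congᴬ (All.universal (λ _ → tt) X) p (λ as l _ → f≗g as l)

∑-upTo-suc : ∀ n (f : ℕ → ℤ) → ∑ (upTo (suc n)) f ≡ ∑ (upTo n) f + f n
∑-upTo-suc n f = begin
  ∑ (upTo (suc n)) f           ≡⟨ cong (λ ys → ∑ ys f) (ListP.upTo-∷ʳ n) ⟨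
  ∑ (upTo n ++ n ∷ []) f       ≡⟨ ∑-++ (upTo n) (n ∷ []) f ⟩
  ∑ (upTo n) f + (f n + 0ℤ)    ≡⟨ cong (_+_ (∑ (upTo n) f)) (ℤP.+-identityʳ (f n)) ⟩
  ∑ (upTo n) f + f n           ∎
  where open ≡-Reasoning

∑-range : ∀ n (f : ℕ → ℤ) → ∑ (range n) f ≡ ∑[ y ∈ upTo n ] f (suc y)
∑-range n f = ∑-map suc (upTo n) f

∑-upTo-C : ∀ n k → ∑[ y ∈ upTo n ] + (y C k) ≡ + (n C suc k)
∑-upTo-C zero    k = refl
∑-upTo-C (suc n) k = begin
  ∑[ y ∈ upTo (suc n) ] + (y C k)  ≡⟨ ∑-upTo-suc n _ ⟩
  (∑[ y ∈ upTo n ] + (y C k)) + + (n C k) ≡⟨ cong (_+ + (n C k)) (∑-upTo-C n k) ⟩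
  + (n C suc k) + + (n C k)        ≡⟨ ℤP.+-comm (+ (n C suc k)) (+ (n C k)) ⟩
  + (n C k) + + (n C suc k)        ≡⟨ cong +_ (nCk+nC[k+1]≡[n+1]C[k+1] n k) ⟩
  + (suc n C suc k)                ∎
  where open ≡-Reasoning

∑-upTo-<ᵇ : ∀ {b n} → b ≤ n → (f : ℕ → ℤ) → ∑[ y ∈ upTo n ] ⟦ y <ᵇ b ⟧· f y ≡ ∑ (upTo b) f
∑-upTo-<ᵇ {b} {n} b≤n f with ℕP.m≤n⇒m<n∨m≡n b≤n
... | inj₂ refl = ∑-congᴬ (upTo b) (All.tabulate ∈-upTo⁻) λ {y} y<b → cong (⟦_⟧· f y) (T⇒≡true (ℕP.<⇒<ᵇ y<b))
... | inj₁ (s≤s {n = n'} b≤n') = begin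
  ∑[ y ∈ upTo (suc n') ] ⟦ y <ᵇ b ⟧· f y                 ≡⟨ ∑-upTo-suc n' _ ⟩
  (∑[ y ∈ upTo n' ] ⟦ y <ᵇ b ⟧· f y) + ⟦ n' <ᵇ b ⟧· f n' ≡⟨ cong₂ _+_ (∑-upTo-<ᵇ b≤n' f) (cong (⟦_⟧· f n') (<ᵇ≡false b≤n')) ⟩
  ∑ (upTo b) f + 0ℤ                                      ≡⟨ ℤP.+-identityʳ _ ⟩
  ∑ (upTo b) f                                           ∎
  where open ≡-Reasoning

-- Strictly decreasing words

strictlyDecreasingBelow : ℕ → List ℕ → Bool
strictlyDecreasingBelow b []       = true
strictlyDecreasingBelow b (x ∷ xs) = (x <ᵇ b) ∧ strictlyDecreasingBelow x xs

strictlyDecreasing : List ℕ → Bool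
strictlyDecreasing []       = true
strictlyDecreasing (x ∷ xs) = strictlyDecreasingBelow x xs

#strictlyDecreasingBelow : ∀ m k {b} → b ≤ m →
  ∑[ as ∈ seqs k (range m) ] ⟦ strictlyDecreasingBelow (suc b) as ⟧ ≡ + (b C k)
#strictlyDecreasingBelow m zero    b≤m = refl
#strictlyDecreasingBelow m (suc k) {b} b≤m = begin
  ∑[ as ∈ seqs (suc k) (range m) ] ⟦ strictlyDecreasingBelow (suc b) as ⟧
    ≡⟨ ∑-seqs-suc k (range m) _ ⟩
  ∑[ x ∈ range m ] ∑[ as ∈ seqs k (range m) ] ⟦ (x <ᵇ suc b) ∧ strictlyDecreasingBelow x as ⟧
    ≡⟨ ∑-cong (range m) (λ x → ∑-⟦∧⟧ (x <ᵇ suc b) (strictlyDecreasingBelow x) (seqs k (range m)) _) ⟩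
  ∑[ x ∈ range m ] ⟦ x <ᵇ suc b ⟧· #below x
    ≡⟨ ∑-range m _ ⟩
  ∑[ y ∈ upTo m ] ⟦ y <ᵇ b ⟧· #below (suc y)
    ≡⟨ ∑-congᴬ (upTo m) (All.tabulate ∈-upTo⁻) (λ {y} y<m → cong (⟦ y <ᵇ b ⟧·_) (#strictlyDecreasingBelow m k (ℕP.<⇒≤ y<m))) ⟩
  ∑[ y ∈ upTo m ] ⟦ y <ᵇ b ⟧· + (y C k)
    ≡⟨ ∑-upTo-<ᵇ b≤m _ ⟩
  ∑[ y ∈ upTo b ] + (y C k)
    ≡⟨ ∑-upTo-C b k ⟩
  + (b C suc k) ∎
  where
  open ≡-Reasoning
  #below : ℕ → ℤ
  #below x = ∑[ as ∈ seqs k (range m) ] ⟦ strictlyDecreasingBelow x as ⟧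

#strictlyDecreasing : ∀ m k → ∑[ as ∈ seqs k (range m) ] ⟦ strictlyDecreasing as ⟧ ≡ + (m C k)
#strictlyDecreasing m zero    = refl
#strictlyDecreasing m (suc k) = begin
  ∑[ as ∈ seqs (suc k) (range m) ] ⟦ strictlyDecreasing as ⟧
    ≡⟨ ∑-seqs-suc k (range m) _ ⟩
  ∑[ x ∈ range m ] ∑[ as ∈ seqs k (range m) ] ⟦ strictlyDecreasingBelow x as ⟧
    ≡⟨ ∑-range m _ ⟩
  ∑[ y ∈ upTo m ] ∑[ as ∈ seqs k (range m) ] ⟦ strictlyDecreasingBelow (suc y) as ⟧
    ≡⟨ ∑-congᴬ (upTo m) (All.tabulate ∈-upTo⁻) (λ y<m → #strictlyDecreasingBelow m k (ℕP.<⇒≤ y<m)) ⟩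
  ∑[ y ∈ upTo m ] + (y C k)
    ≡⟨ ∑-upTo-C m k ⟩
  + (m C suc k) ∎
  where open ≡-Reasoning

-- Words compatible with the index sequence of a monomial

length-iSeqAux : ∀ k α → length (iSeqAux k α) ≡ sumℕ α
length-iSeqAux k []      = refl
length-iSeqAux k (a ∷ α) = begin
  length (iSeqAux (suc k) α ++ replicate a (- (+ k)))         ≡⟨ ListP.length-++ (iSeqAux (suc k) α) ⟩
  length (iSeqAux (suc k) α) ℕ.+ length (replicate a (- (+ k))) ≡⟨ cong₂ ℕ._+_ (length-iSeqAux (suc k) α) (ListP.length-replicate a) ⟩
  sumℕ α ℕ.+ a                                              ≡⟨ ℕP.+-comm (sumℕ α) a ⟩
  a ℕ.+ sumℕ α                                              ∎
  where open ≡-Reasoning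

iSeqAux-below : ∀ k α → All (λ i → (i <ℤᵇ (- (+ k))) ≡ true) (iSeqAux (suc k) α)
iSeqAux-below k α = All-iSeqAux (suc k) α λ k<j → <⇒<ℤᵇ (ℤP.neg-mono-< (ℤ.+<+ k<j))
  where
  All-iSeqAux : ∀ {P : ℤ → Set} j α → (∀ {j'} → j ≤ j' → P (- (+ j'))) → All P (iSeqAux j α)
  All-iSeqAux j []      Pj = []
  All-iSeqAux j (a ∷ α) Pj =
    AllP.++⁺ (All-iSeqAux (suc j) α (Pj ∘ ℕP.<⇒≤)) (AllP.replicate⁺ a (Pj ℕP.≤-refl))

zipL-++ : ∀ as bs (is js : List ℤ) → length as ≡ length is → zipL (as ++ bs) (is ++ js) ≡ zipL as is ++ zipL bs js
zipL-++ []       bs []       js _  = refl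
zipL-++ (a ∷ as) bs (i ∷ is) js eq = cong ((a , i) ∷_) (zipL-++ as bs is js (ℕP.suc-injective eq))

All-zipL : ∀ {P : ℤ → Set} as is → All P is → All (P ∘ proj₂) (zipL as is)
All-zipL []       is       _          = []
All-zipL (a ∷ as) []       _          = []
All-zipL (a ∷ as) (i ∷ is) (pi ∷ pis) = pi ∷ All-zipL as is pis

compat-++ : ∀ c xs ys → All (λ p → (proj₂ p <ℤᵇ c) ≡ true) xs → All (λ p → proj₂ p ≡ c) ys →
            compat (xs ++ ys) ≡ compat xs ∧ compat ys
compat-++ c []                 ys               _            _            = refl
compat-++ c (x ∷ [])           []               _            _            = refl
compat-++ c ((a , i) ∷ [])     ((b , j) ∷ ys)   (i<c ∷ [])   (refl ∷ _)   rewrite i<c =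
  cong (_∧ compat ((b , j) ∷ ys)) (BoolP.∨-zeroʳ (not (a ℕ.≤ᵇ b)))
compat-++ c ((a , i) ∷ x ∷ xs) ys               (_ ∷ xs<c)   ys≡c         =
  trans (cong ((not (a ℕ.≤ᵇ proj₁ x) ∨ (i <ℤᵇ proj₂ x)) ∧_) (compat-++ c (x ∷ xs) ys xs<c ys≡c))
        (sym (BoolP.∧-assoc _ (compat (x ∷ xs)) (compat ys)))

compat-replicate : ∀ as c → compat (zipL as (replicate (length as) c)) ≡ strictlyDecreasing as
compat-replicate []       c = refl
compat-replicate (a ∷ as) c = go a as
  where
  go : ∀ a as → compat ((a , c) ∷ zipL as (replicate (length as) c)) ≡ strictlyDecreasingBelow a as
  go a []       = refl
  go a (b ∷ as) rewrite <ℤᵇ-irrefl c | BoolP.∨-identityʳ (not (a ℕ.≤ᵇ b)) | not-≤ᵇ a b = cong ((b <ᵇ a) ∧_) (go b as)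

#compatible : ∀ m k α →
  ∑[ as ∈ seqs (sumℕ α) (range m) ] ⟦ compat (zipL as (iSeqAux k α)) ⟧ ≡ prodℤ (map (λ a → + (m C a)) α)
#compatible m k []      = refl
#compatible m k (a ∷ α) = begin
  ∑[ as ∈ seqs (a ℕ.+ sumℕ α) X ] ⟦ compat (zipL as (is ++ block)) ⟧
    ≡⟨ cong (λ p → ∑[ as ∈ seqs p X ] ⟦ compat (zipL as (is ++ block)) ⟧) (ℕP.+-comm a (sumℕ α)) ⟩
  ∑[ as ∈ seqs (sumℕ α ℕ.+ a) X ] ⟦ compat (zipL as (is ++ block)) ⟧
    ≡⟨ ∑-seqs-+ (sumℕ α) a X _ ⟩
  ∑[ bs ∈ seqs (sumℕ α) X ] ∑[ cs ∈ seqs a X ] ⟦ compat (zipL (bs ++ cs) (is ++ block)) ⟧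
    ≡⟨ ∑-seqs-cong (sumℕ α) (λ bs |bs| → ∑-seqs-cong a (λ cs |cs| → factorise bs cs |bs| |cs|)) ⟩
  ∑[ bs ∈ seqs (sumℕ α) X ] ∑[ cs ∈ seqs a X ] (⟦ compat (zipL bs is) ⟧ * ⟦ strictlyDecreasing cs ⟧)
    ≡⟨ ∑-*-∑ (seqs (sumℕ α) X) (seqs a X) _ _ ⟩
  (∑[ bs ∈ seqs (sumℕ α) X ] ⟦ compat (zipL bs is) ⟧) * (∑[ cs ∈ seqs a X ] ⟦ strictlyDecreasing cs ⟧)
    ≡⟨ cong₂ _*_ (#compatible m (suc k) α) (#strictlyDecreasing m a) ⟩
  prodℤ (map (λ a → + (m C a)) α) * + (m C a)
    ≡⟨ ℤP.*-comm (prodℤ (map (λ a → + (m C a)) α)) (+ (m C a)) ⟩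
  prodℤ (map (λ a → + (m C a)) (a ∷ α)) ∎
  where
  open ≡-Reasoning
  X : List ℕ
  X = range m
  is block : List ℤ
  is    = iSeqAux (suc k) α
  block = replicate a (- (+ k))
  factorise : ∀ bs cs → length bs ≡ sumℕ α → length cs ≡ a →
    ⟦ compat (zipL (bs ++ cs) (is ++ block)) ⟧ ≡ ⟦ compat (zipL bs is) ⟧ * ⟦ strictlyDecreasing cs ⟧
  factorise bs cs |bs| refl = begin
    ⟦ compat (zipL (bs ++ cs) (is ++ block)) ⟧
      ≡⟨ cong (⟦_⟧ ∘ compat) (zipL-++ bs cs is block (trans |bs| (sym (length-iSeqAux (suc k) α)))) ⟩
    ⟦ compat (zipL bs is ++ zipL cs block) ⟧
      ≡⟨ cong ⟦_⟧ (compat-++ (- (+ k)) _ _ (All-zipL bs is (iSeqAux-below k α)) (All-zipL cs block (AllP.replicate⁺ a refl))) ⟩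
    ⟦ compat (zipL bs is) ∧ compat (zipL cs block) ⟧
      ≡⟨ cong (λ b → ⟦ compat (zipL bs is) ∧ b ⟧) (compat-replicate cs (- (+ k))) ⟩
    ⟦ compat (zipL bs is) ∧ strictlyDecreasing cs ⟧
      ≡⟨ ⟦∧⟧-* (compat (zipL bs is)) _ ⟩
    ⟦ compat (zipL bs is) ⟧ * ⟦ strictlyDecreasing cs ⟧ ∎

-- Every word has exactly one Hecke product in S_n

==-true : ∀ {m n} → m ≡ n → (m == n) ≡ true
==-true {m} {n} m≡n = trans (isYes≗does (m ℕ.≟ n)) (dec-true (m ℕ.≟ n) m≡n)

==-false : ∀ {m n} → m ≢ n → (m == n) ≡ false
==-false {m} {n} m≢n = trans (isYes≗does (m ℕ.≟ n)) (dec-false (m ℕ.≟ n) m≢n)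

==-injective : ∀ {f : ℕ → ℕ} → Injective _≡_ _≡_ f → ∀ x y → (f x == f y) ≡ (x == y)
==-injective f-inj x y with x ℕ.≟ y
... | yes refl = ==-true refl
... | no  x≢y  = ==-false (x≢y ∘ f-inj)

notIn-map : ∀ {f : ℕ → ℕ} → Injective _≡_ _≡_ f → ∀ x ys → notIn (f x) (map f ys) ≡ notIn x ys
notIn-map f-inj x []       = refl
notIn-map f-inj x (y ∷ ys) = cong₂ (λ b c → not b ∧ c) (==-injective f-inj x y) (notIn-map f-inj x ys)

noDup-map : ∀ {f : ℕ → ℕ} → Injective _≡_ _≡_ f → ∀ xs → noDup (map f xs) ≡ noDup xs
noDup-map f-inj []       = refl
noDup-map f-inj (x ∷ xs) = cong₂ _∧_ (notIn-map f-inj x xs) (noDup-map f-inj xs)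

noDup-upTo : ∀ n → noDup (upTo n) ≡ true
noDup-upTo zero    = refl
noDup-upTo (suc n) rewrite sym (ListP.map-upTo suc n) | noDup-map ℕP.suc-injective (upTo n) =
  cong₂ _∧_ (notIn-zero (upTo n)) (noDup-upTo n)
  where
  notIn-zero : ∀ xs → notIn 0 (map suc xs) ≡ true
  notIn-zero []       = refl
  notIn-zero (x ∷ xs) = notIn-zero xs

sw-i : ∀ i → sw i i ≡ suc i
sw-i i rewrite ==-true (refl {x = i}) = refl

sw-suc : ∀ i → sw i (suc i) ≡ i
sw-suc i rewrite ==-false (ℕP.1+n≢n {i}) | ==-true (refl {x = suc i}) = refl

sw-other : ∀ {i v} → v ≢ i → v ≢ suc i → sw i v ≡ v
sw-other v≢i v≢1+i rewrite ==-false v≢i | ==-false v≢1+i = refl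

sw-involutive : ∀ i v → sw i (sw i v) ≡ v
sw-involutive i v = cases (v ℕ.≟ i) (v ℕ.≟ suc i)
  where
  cases : Dec (v ≡ i) → Dec (v ≡ suc i) → sw i (sw i v) ≡ v
  cases (yes refl) _          = trans (cong (sw v) (sw-i v)) (sw-suc v)
  cases (no v≢i)   (yes refl) = trans (cong (sw i) (sw-suc i)) (sw-i i)
  cases (no v≢i)   (no v≢1+i) = trans (cong (sw i) (sw-other v≢i v≢1+i)) (sw-other v≢i v≢1+i)

sw-injective : ∀ i → Injective _≡_ _≡_ (sw i)
sw-injective i {x} {y} eq = trans (sym (sw-involutive i x)) (trans (cong (sw i) eq) (sw-involutive i y))

InRange : ℕ → ℕ → Set
InRange n e = 1 ≤ e × e ≤ n

All-InRange-range : ∀ n → All (InRange n) (range n)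
All-InRange-range n = AllP.map⁺ (All.tabulate λ y∈ → s≤s z≤n , ∈-upTo⁻ y∈)

sw-InRange : ∀ {n i v} → 1 ≤ i → i < n → InRange n v → InRange n (sw i v)
sw-InRange {n} {i} {v} 1≤i i<n v∈ = cases (v ℕ.≟ i) (v ℕ.≟ suc i)
  where
  cases : Dec (v ≡ i) → Dec (v ≡ suc i) → InRange n (sw i v)
  cases (yes refl) _          = subst (InRange n) (sym (sw-i v)) (s≤s z≤n , i<n)
  cases (no v≢i)   (yes refl) = subst (InRange n) (sym (sw-suc i)) (1≤i , ℕP.<⇒≤ i<n)
  cases (no v≢i)   (no v≢1+i) = subst (InRange n) (sym (sw-other v≢i v≢1+i)) v∈

IsPermutation : ℕ → List ℕ → Set
IsPermutation n w = length w ≡ n × All (InRange n) w × noDup w ≡ true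

idPerm-isPermutation : ∀ n → IsPermutation n (idPerm n)
idPerm-isPermutation n =
  trans (ListP.length-map suc (upTo n)) (ListP.length-upTo n) ,
  All-InRange-range n ,
  trans (noDup-map ℕP.suc-injective (upTo n)) (noDup-upTo n)

leftMul-isPermutation : ∀ {n i w} → 1 ≤ i → i < n → IsPermutation n w → IsPermutation n (leftMul i w)
leftMul-isPermutation {n} {i} {w} 1≤i i<n (|w| , w⊆ , w-noDup) =
  trans (ListP.length-map (sw i) w) |w| ,
  AllP.map⁺ (All.map (sw-InRange 1≤i i<n) w⊆) ,
  trans (noDup-map (sw-injective i) w) w-noDup

hstep-isPermutation : ∀ {n i w} → 1 ≤ i → i < n → IsPermutation n w → IsPermutation n (hstep i w)
hstep-isPermutation {n} {i} {w} 1≤i i<n w-perm with len w <ᵇ len (leftMul i w)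
... | true  = leftMul-isPermutation 1≤i i<n w-perm
... | false = w-perm

hecke-isPermutation : ∀ m as → All (InRange m) as → IsPermutation (suc m) (hecke (suc m) as)
hecke-isPermutation m []       []               = idPerm-isPermutation (suc m)
hecke-isPermutation m (a ∷ as) ((1≤a , a≤m) ∷ as⊆) =
  hstep-isPermutation 1≤a (s≤s a≤m) (hecke-isPermutation m as as⊆)

∑-upTo-≡ᵇ : ∀ {n e} → e < n → (s : ℤ) → ∑[ y ∈ upTo n ] ⟦ e ≡ᵇ y ⟧· s ≡ s
∑-upTo-≡ᵇ {suc n} {e} e<n s rewrite sym (ListP.map-upTo suc n) | ∑-map suc (upTo n) (λ y → ⟦ e ≡ᵇ y ⟧· s) = split e e<n
  where
  split : ∀ e → e < suc n → ⟦ e ≡ᵇ 0 ⟧· s + (∑[ y ∈ upTo n ] ⟦ e ≡ᵇ suc y ⟧· s) ≡ s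
  split zero    _         = trans (cong (_+_ s) (∑-zero (upTo n))) (ℤP.+-identityʳ s)
  split (suc e) (s≤s e<n) = trans (ℤP.+-identityˡ _) (∑-upTo-≡ᵇ e<n s)

∑-range-≡ᵇ : ∀ {n e} → InRange n e → (s : ℤ) → ∑[ y ∈ range n ] ⟦ e ≡ᵇ y ⟧· s ≡ s
∑-range-≡ᵇ {n} {suc e} (_ , e<n) s = trans (∑-range n _) (∑-upTo-≡ᵇ e<n s)

==L-∷ : ∀ e v y t → ((e ∷ v) ==L (y ∷ t)) ≡ (e ≡ᵇ y) ∧ (v ==L t)
==L-∷ e v y t = trans (isYes≗does (ListP.≡-dec ℕ._≟_ (e ∷ v) (y ∷ t)))
                      (cong ((e ≡ᵇ y) ∧_) (sym (isYes≗does (ListP.≡-dec ℕ._≟_ v t))))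

∑-seqs-==L : ∀ {n v} p → length v ≡ p → All (InRange n) v → (s : ℤ) →
             ∑[ w ∈ seqs p (range n) ] ⟦ v ==L w ⟧· s ≡ s
∑-seqs-==L {v = []}    zero    _   []          s = ℤP.+-identityʳ s
∑-seqs-==L {n} {e ∷ v} (suc p) |v| (e∈ ∷ v⊆) s = begin
  ∑[ w ∈ seqs (suc p) (range n) ] ⟦ (e ∷ v) ==L w ⟧· s
    ≡⟨ ∑-seqs-suc p (range n) _ ⟩
  ∑[ y ∈ range n ] ∑[ t ∈ seqs p (range n) ] ⟦ (e ∷ v) ==L (y ∷ t) ⟧· s
    ≡⟨ ∑-cong (range n) (λ y → trans (∑-cong (seqs p (range n)) λ t → cong (⟦_⟧· s) (==L-∷ e v y t))
                                     (∑-⟦∧⟧ (e ≡ᵇ y) (v ==L_) (seqs p (range n)) _)) ⟩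
  ∑[ y ∈ range n ] ⟦ e ≡ᵇ y ⟧· (∑[ t ∈ seqs p (range n) ] ⟦ v ==L t ⟧· s)
    ≡⟨ ∑-cong (range n) (λ y → cong (⟦ e ≡ᵇ y ⟧·_) (∑-seqs-==L p (ℕP.suc-injective |v|) v⊆ s)) ⟩
  ∑[ y ∈ range n ] ⟦ e ≡ᵇ y ⟧· s
    ≡⟨ ∑-range-≡ᵇ e∈ s ⟩
  s ∎
  where open ≡-Reasoning

∑-Sn-==L : ∀ {n v} → IsPermutation n v → (s : ℤ) → ∑[ w ∈ Sn n ] ⟦ v ==L w ⟧· s ≡ s
∑-Sn-==L {n} {v} (|v| , v⊆ , v-noDup) s = begin
  ∑[ w ∈ Sn n ] ⟦ v ==L w ⟧· s                             ≡⟨ ∑-filterᵇ noDup (seqs n (range n)) _ ⟩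
  ∑[ w ∈ seqs n (range n) ] ⟦ noDup w ⟧· ⟦ v ==L w ⟧· s   ≡⟨ ∑-cong (seqs n (range n)) noDup-redundant ⟩
  ∑[ w ∈ seqs n (range n) ] ⟦ v ==L w ⟧· s                 ≡⟨ ∑-seqs-==L n |v| v⊆ s ⟩
  s                                                         ∎
  where
  open ≡-Reasoning
  noDup-redundant : ∀ w → ⟦ noDup w ⟧· ⟦ v ==L w ⟧· s ≡ ⟦ v ==L w ⟧· s
  noDup-redundant w with ListP.≡-dec ℕ._≟_ v w
  ... | yes refl rewrite v-noDup = refl
  ... | no _     with noDup w
  ...   | true  = refl
  ...   | false = refl

-- Coefficients of (1 - x)^m

sgn-+ : ∀ a b → sgn (a ℕ.+ b) ≡ sgn a * sgn b
sgn-+ zero    b = sym (ℤP.*-identityˡ (sgn b))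
sgn-+ (suc a) b = trans (cong -_ (sgn-+ a b)) (ℤP.neg-distribˡ-* (sgn a) (sgn b))

sgn-*-sgn : ∀ a → sgn a * sgn a ≡ 1ℤ
sgn-*-sgn zero    = refl
sgn-*-sgn (suc a) = trans (neg-*-neg (sgn a)) (sgn-*-sgn a)
  where
  neg-*-neg : ∀ s → - s * - s ≡ s * s
  neg-*-neg = solve-∀

sgn-*-sgn-+ : ∀ a b → sgn b * sgn (a ℕ.+ b) ≡ sgn a
sgn-*-sgn-+ a b = begin
  sgn b * sgn (a ℕ.+ b)     ≡⟨ cong (sgn b *_) (sgn-+ a b) ⟩
  sgn b * (sgn a * sgn b)   ≡⟨ ℤP.*-comm (sgn b) _ ⟩
  sgn a * sgn b * sgn b     ≡⟨ ℤP.*-assoc (sgn a) (sgn b) (sgn b) ⟩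
  sgn a * (sgn b * sgn b)   ≡⟨ cong (sgn a *_) (sgn-*-sgn b) ⟩
  sgn a * 1ℤ                ≡⟨ ℤP.*-identityʳ (sgn a) ⟩
  sgn a                     ∎
  where open ≡-Reasoning

prodℤ-sgn : ∀ (f : ℕ → ℤ) α → prodℤ (map (λ a → sgn a * f a) α) ≡ sgn (sumℕ α) * prodℤ (map f α)
prodℤ-sgn f []      = refl
prodℤ-sgn f (a ∷ α) = begin
  sgn a * f a * prodℤ (map (λ a → sgn a * f a) α) ≡⟨ cong (sgn a * f a *_) (prodℤ-sgn f α) ⟩
  sgn a * f a * (sgn (sumℕ α) * prodℤ (map f α))  ≡⟨ interchange (sgn a) (f a) _ _ ⟩
  sgn a * sgn (sumℕ α) * (f a * prodℤ (map f α))  ≡⟨ cong (_* (f a * prodℤ (map f α))) (sgn-+ a (sumℕ α)) ⟨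
  sgn (a ℕ.+ sumℕ α) * (f a * prodℤ (map f α))    ∎
  where
  open ≡-Reasoning
  interchange : ∀ a b c d → a * b * (c * d) ≡ a * c * (b * d)
  interchange = solve-∀

coeffAt-polyAdd : ∀ p q k → coeffAt (polyAdd p q) k ≡ coeffAt p k + coeffAt q k
coeffAt-polyAdd []      q       k       = sym (ℤP.+-identityˡ _)
coeffAt-polyAdd (a ∷ p) []      k       = sym (ℤP.+-identityʳ _)
coeffAt-polyAdd (a ∷ p) (b ∷ q) zero    = refl
coeffAt-polyAdd (a ∷ p) (b ∷ q) (suc k) = coeffAt-polyAdd p q k

coeffAt-neg : ∀ p k → coeffAt (map -_ p) k ≡ - coeffAt p k
coeffAt-neg []      k       = refl
coeffAt-neg (a ∷ p) zero    = refl
coeffAt-neg (a ∷ p) (suc k) = coeffAt-neg p k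

coeffAt-powOneMinusX : ∀ m a → coeffAt (powOneMinusX m) a ≡ sgn a * + (m C a)
coeffAt-powOneMinusX zero    zero    = refl
coeffAt-powOneMinusX zero    (suc a) = sym (ℤP.*-zeroʳ (sgn (suc a)))
coeffAt-powOneMinusX (suc m) zero    =
  trans (coeffAt-polyAdd (powOneMinusX m) _ zero) (trans (ℤP.+-identityʳ _) (coeffAt-powOneMinusX m zero))
coeffAt-powOneMinusX (suc m) (suc a) = begin
  coeffAt (powOneMinusX (suc m)) (suc a)
    ≡⟨ coeffAt-polyAdd (powOneMinusX m) _ (suc a) ⟩
  coeffAt (powOneMinusX m) (suc a) + coeffAt (map -_ (powOneMinusX m)) a
    ≡⟨ cong₂ _+_ (coeffAt-powOneMinusX m (suc a)) (trans (coeffAt-neg (powOneMinusX m) a) (cong -_ (coeffAt-powOneMinusX m a))) ⟩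
  - sgn a * + (m C suc a) + - (sgn a * + (m C a))
    ≡⟨ factor (sgn a) _ _ ⟩
  - sgn a * (+ (m C a) + + (m C suc a))
    ≡⟨ cong (λ c → - sgn a * + c) (nCk+nC[k+1]≡[n+1]C[k+1] m a) ⟩
  sgn (suc a) * + (suc m C suc a) ∎
  where
  open ≡-Reasoning
  factor : ∀ s c₁ c₀ → - s * c₁ + - (s * c₀) ≡ - s * (c₀ + c₁)
  factor = solve-∀

rhsCoeff-suc : ∀ m α → rhsCoeff (suc m) α ≡ sgn (sumℕ α) * prodℤ (map (λ a → + (m C a)) α)
rhsCoeff-suc m α =
  trans (cong prodℤ (ListP.map-cong (coeffAt-powOneMinusX m) α)) (prodℤ-sgn (λ a → + (m C a)) α)

lhsCoeff-suc : ∀ m α → lhsCoeff (suc m) α ≡ sgn (sumℕ α) * (∑[ as ∈ seqs (sumℕ α) (range m) ] ⟦ compat (zipL as (iSeq α)) ⟧)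
lhsCoeff-suc m α = begin
  lhsCoeff (suc m) α
    ≡⟨ ∑-cong (Sn (suc m)) (λ w → trans (∑-*ˡ (sgn (len w)) words _) (∑-cong words (cancel-sign w))) ⟩
  ∑[ w ∈ Sn (suc m) ] ∑[ as ∈ words ] ⟦ compatible as ∧ (hecke (suc m) as ==L w) ⟧· sgn p
    ≡⟨ ∑-comm (Sn (suc m)) words _ ⟩
  ∑[ as ∈ words ] ∑[ w ∈ Sn (suc m) ] ⟦ compatible as ∧ (hecke (suc m) as ==L w) ⟧· sgn p
    ≡⟨ ∑-seqs-congᴬ (All-InRange-range m) p (λ as _ as⊆ → unique-hecke-product as as⊆) ⟩
  ∑[ as ∈ words ] sgn p * ⟦ compatible as ⟧
    ≡⟨ ∑-*ˡ (sgn p) words _ ⟨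
  sgn p * (∑[ as ∈ words ] ⟦ compatible as ⟧) ∎
  where
  open ≡-Reasoning
  p : ℕ
  p = sumℕ α
  words : List (List ℕ)
  words = seqs p (range m)
  compatible : List ℕ → Bool
  compatible as = compat (zipL as (iSeq α))
  cancel-sign : ∀ w as → sgn (len w) * ⟦ compatible as ∧ (hecke (suc m) as ==L w) ⟧· sgn (p ℕ.+ len w)
                       ≡ ⟦ compatible as ∧ (hecke (suc m) as ==L w) ⟧· sgn p
  cancel-sign w as = trans (*-⟦⟧ (sgn (len w)) _ _) (cong (⟦ compatible as ∧ (hecke (suc m) as ==L w) ⟧·_) (sgn-*-sgn-+ p (len w)))
  unique-hecke-product : ∀ as → All (InRange m) as →
    ∑[ w ∈ Sn (suc m) ] ⟦ compatible as ∧ (hecke (suc m) as ==L w) ⟧· sgn p ≡ sgn p * ⟦ compatible as ⟧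
  unique-hecke-product as as⊆ = begin
    ∑[ w ∈ Sn (suc m) ] ⟦ compatible as ∧ (hecke (suc m) as ==L w) ⟧· sgn p
      ≡⟨ ∑-⟦∧⟧ (compatible as) (hecke (suc m) as ==L_) (Sn (suc m)) _ ⟩
    ⟦ compatible as ⟧· (∑[ w ∈ Sn (suc m) ] ⟦ hecke (suc m) as ==L w ⟧· sgn p)
      ≡⟨ cong (⟦ compatible as ⟧·_) (∑-Sn-==L (hecke-isPermutation m as as⊆) (sgn p)) ⟩
    ⟦ compatible as ⟧· sgn p
      ≡⟨ ⟦⟧-*ʳ (compatible as) (sgn p) ⟩
    sgn p * ⟦ compatible as ⟧ ∎

lemma8p17 : (n : ℕ) → 1 ≤ n → (α : List ℕ) → lhsCoeff n α ≡ rhsCoeff n α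
lemma8p17 (suc m) _ α = begin
  lhsCoeff (suc m) α                                                         ≡⟨ lhsCoeff-suc m α ⟩
  sgn (sumℕ α) * (∑[ as ∈ seqs (sumℕ α) (range m) ] ⟦ compat (zipL as (iSeq α)) ⟧) ≡⟨ cong (sgn (sumℕ α) *_) (#compatible m 0 α) ⟩
  sgn (sumℕ α) * prodℤ (map (λ a → + (m C a)) α)                            ≡⟨ rhsCoeff-suc m α ⟨
  rhsCoeff (suc m) α                                                         ∎
  where open ≡-Reasoning
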